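{- For every integer $n\ge 1$, $|\mathfrak D^1_{2n}(1342,4213)|=2^{n-1}$.
   Context: A permutation $\sigma\in\mathfrak S_m$ contains a pattern $\tau\in\mathfrak S_k$ if $\sigma$ has a subsequence $(\sigma(i_1),\dots,\sigma(i_k))$, $i_1<\dots<i_k$, order-isomorphic to $\tau$; otherwise $\sigma$ avoids $\tau$. A Dumont permutation of the first kind of length $2n$ is a permutation $\pi\in\mathfrak S_{2n}$ such that for every $i$: if $\pi(i)$ is even then $i<2n$ and $\pi(i)>\pi(i+1)$; if $\pi(i)$ is odd then $i=2n$ or $\pi(i)<\pi(i+1)$. $\mathfrak D^1_{2n}(T)$ denotes the set of such permutations avoiding every pattern in $T$. -}

module Defs where

open import Data.Bool using (Bool; true; false; _∧_; _∨_; not; T)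
open import Data.Nat using (ℕ; zero; suc; _+_; _*_; _<ᵇ_; _≡ᵇ_; _^_; _∸_)
open import Data.Fin using (Fin; toℕ)
open import Data.List using (List; []; _∷_; length; map)
open import Data.Bool.ListAction using (all; any)
open import Data.Vec using (Vec; toList)
open import Data.Product using (Σ)

-- Permutations of {1..m} are represented by their one-line notation
-- π(1) … π(m) as a vector of values in Fin m (value k stands for k+1).
-- A vector is a permutation iff its entries are pairwise distinct.

distinctᵇ : List ℕ → Bool
distinctᵇ []       = true
distinctᵇ (x ∷ xs) = not (any (λ y → x ≡ᵇ y) xs) ∧ distinctᵇ xs

evenᵇ : ℕ → Bool
evenᵇ zero = true
evenᵇ (suc zero) = false
evenᵇ (suc (suc k)) = evenᵇ k

subseqs : ℕ → List ℕ → List (List ℕ)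
subseqs zero    _        = [] ∷ []
subseqs (suc k) []       = []
subseqs (suc k) (x ∷ xs) = map (x ∷_) (subseqs k xs) Data.List.++ subseqs (suc k) xs

pairsOK : ℕ → ℕ → List ℕ → List ℕ → Bool
pairsOK x y [] [] = true
pairsOK x y (a ∷ as) (b ∷ bs) = ((x <ᵇ a) ≡ᵇᵇ (y <ᵇ b)) ∧ ((a <ᵇ x) ≡ᵇᵇ (b <ᵇ y)) ∧ pairsOK x y as bs
  where
  _≡ᵇᵇ_ : Bool → Bool → Bool
  true  ≡ᵇᵇ b = b
  false ≡ᵇᵇ b = not b
pairsOK x y _ _ = false

orderIso : List ℕ → List ℕ → Bool
orderIso [] [] = true
orderIso (a ∷ as) (b ∷ bs) = pairsOK a b as bs ∧ orderIso as bs
orderIso _ _ = false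

containsᵇ : List ℕ → List ℕ → Bool
containsᵇ σ τ = any (λ s → orderIso s τ) (subseqs (length τ) σ)

avoidsᵇ : List ℕ → List ℕ → Bool
avoidsᵇ σ τ = not (containsᵇ σ τ)

-- Dumont condition (values are 1-based: value v stands for v+1 in Fin):
-- if π(i) is even then i < 2n and π(i) > π(i+1);
-- if π(i) is odd then i = 2n or π(i) < π(i+1).
dumontᵇ : List ℕ → Bool
dumontᵇ []           = true
dumontᵇ (x ∷ [])     = not (evenᵇ x)
dumontᵇ (x ∷ y ∷ xs) = (if evenᵇ x then y <ᵇ x else x <ᵇ y) ∧ dumontᵇ (y ∷ xs)
  where open import Data.Bool using (if_then_else_)

oneLine : {m : ℕ} → Vec (Fin m) m → List ℕ
oneLine v = map (λ i → suc (toℕ i)) (toList v)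

InD1 : (n : ℕ) → List (List ℕ) → Vec (Fin (2 * n)) (2 * n) → Set
InD1 n Ts v = T (distinctᵇ (oneLine v) ∧ dumontᵇ (oneLine v) ∧ all (avoidsᵇ (oneLine v)) Ts)

D1 : (n : ℕ) → List (List ℕ) → Set
D1 n Ts = Σ (Vec (Fin (2 * n)) (2 * n)) (InD1 n Ts)

-- The last entry x of a permutation in D¹_{2n}(1342, 4213) is odd.  If 3 ≤ x ≤ 2n−3, then the even
-- value x−1 and the odd value x+2 both occur earlier; as x−1 is followed by a smaller entry and x+2
-- by a larger one, x forms a 1342 or a 4213 with three of these entries.  Hence x ∈ {1, 2n−1}, and
-- a few more pattern arguments show that the permutation ends with the block "2 1" or with the
-- block "2n 2n−1".  Removing this final block is a bijection
--   D¹_{2n+2}(1342, 4213) ≅ D¹_{2n}(1342, 4213) ⊎ D¹_{2n}(1342, 4213),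
-- provided that after removing "2 1" every remaining value v is replaced by 2n+3−v: this
-- complementation swaps parities and reverses the order, so it preserves the Dumont condition and
-- exchanges the patterns 1342 and 4213.

module Submission where

open import Defs
open import Data.Bool using (Bool; true; false; not; _∧_; _xor_; T; if_then_else_)
open import Data.Bool.Properties
  using (not-involutive; not-distribˡ-xor; T-∧; T-≡; T-not-≡; T-irrelevant)
open import Data.Bool.ListAction using (all; any)
open import Data.Nat
open import Data.Nat.Properties
open import Data.Fin using (Fin; toℕ; fromℕ<) renaming (zero to fzero; suc to fsuc)
open import Data.Fin.Properties using (toℕ<n; toℕ-injective; fromℕ<-injective; injective⇒≤; +↔⊎)
open import Data.Vec using (Vec; toList) renaming ([] to []ᵥ; _∷_ to _∷ᵥ_)
open import Data.List using (List; []; _∷_; length; map; take; drop; _++_)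
open import Data.List.Properties using (length-++; length-map; length-take; map-∘; map-id-local)
open import Data.List.Membership.Propositional using (_∈_; find; lose)
open import Data.List.Membership.Propositional.Properties
  using (∈-++⁻; ∈-++⁺ˡ; ∈-++⁺ʳ; ∈-map⁺; map∷⁻)
open import Data.List.Relation.Unary.All as All using (All; []; _∷_)
open import Data.List.Relation.Unary.All.Properties using (all⁺; all⁻; take⁺)
open import Data.List.Relation.Unary.Any using (here)
open import Data.List.Relation.Unary.Any.Properties using (any⁺; any⁻)
open import Data.List.Relation.Binary.Pointwise using (Pointwise; []; _∷_)
open import Data.Product using (Σ; ∃-syntax; _×_; _,_; proj₁; proj₂; swap)
open import Data.Sum using (_⊎_; inj₁; inj₂)
open import Data.Sum.Function.Propositional using (_⊎-↔_)
open import Data.Unit using (⊤; tt)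
open import Data.Empty using (⊥; ⊥-elim)
open import Function using (_∘_; _⇔_; mk⇔; Equivalence; _↔_; mk↔ₛ′; _⤖_; case_of_)
open import Function.Definitions using (Injective)
open import Function.Construct.Composition using (_↔-∘_)
open import Function.Construct.Symmetry using (↔-sym)
open import Function.Properties.Inverse using (↔⇒⤖)
open import Relation.Nullary using (¬_; yes; no)
open import Relation.Nullary.Decidable using (from-yes)
open import Relation.Binary.Definitions using (Tri; tri<; tri≈; tri>)
open import Relation.Binary.PropositionalEquality

Even Odd : ℕ → Set
Even n = evenᵇ n ≡ true
Odd  n = evenᵇ n ≡ false

evenᵇ-suc : ∀ n → evenᵇ (suc n) ≡ not (evenᵇ n)
evenᵇ-suc zero    = refl
evenᵇ-suc (suc n) = sym (trans (cong not (evenᵇ-suc n)) (not-involutive _))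

evenᵇ-+ : ∀ m n → evenᵇ (m + n) ≡ not (evenᵇ m xor evenᵇ n)
evenᵇ-+ zero    n = sym (not-involutive _)
evenᵇ-+ (suc m) n = begin
  evenᵇ (suc (m + n))               ≡⟨ evenᵇ-suc (m + n) ⟩
  not (evenᵇ (m + n))               ≡⟨ cong not (evenᵇ-+ m n) ⟩
  not (not (evenᵇ m xor evenᵇ n))   ≡⟨ cong not (not-distribˡ-xor (evenᵇ m) (evenᵇ n)) ⟩
  not (not (evenᵇ m) xor evenᵇ n)   ≡⟨ cong (λ b → not (b xor evenᵇ n)) (evenᵇ-suc m) ⟨
  not (evenᵇ (suc m) xor evenᵇ n)   ∎
  where open ≡-Reasoning

even⇒odd-suc : ∀ {n} → Even n → Odd (suc n)
even⇒odd-suc {n} even = trans (evenᵇ-suc n) (cong not even)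

odd-suc⇒even : ∀ {n} → Odd (suc n) → Even n
odd-suc⇒even {n} odd = trans (sym (not-involutive _)) (cong not (trans (sym (evenᵇ-suc n)) odd))

even⇒¬odd : ∀ {n} → Even n → ¬ Odd n
even⇒¬odd even odd with () ← trans (sym even) odd

even-or-odd : ∀ n → Even n ⊎ Odd n
even-or-odd n with evenᵇ n
... | true  = inj₁ refl
... | false = inj₂ refl

odd-sum⇒opposite-parity : ∀ m n → Odd (m + n) → evenᵇ n ≡ not (evenᵇ m)
odd-sum⇒opposite-parity m n odd with evenᵇ m | evenᵇ n | trans (sym (evenᵇ-+ m n)) odd
... | true  | false | _ = refl
... | false | true  | _ = refl

even-pos⇒≥2 : ∀ {n} → Even n → 0 < n → 2 ≤ n
even-pos⇒≥2 {suc (suc n)} _ _ = s≤s (s≤s z≤n)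

odd-near-even⇒pred : ∀ {x n} → Odd x → Even n → x ≤ n → n ≤ suc x → suc x ≡ n
odd-near-even⇒pred {x} odd even x≤n n≤1+x with m≤n⇒m<n∨m≡n x≤n
... | inj₁ x<n  = ≤-antisym x<n n≤1+x
... | inj₂ refl = ⊥-elim (even⇒¬odd {x} even odd)

shift-≢ : ∀ a b {m} → a ≢ b → a + m ≢ b + m
shift-≢ a b {m} a≢b e = a≢b (+-cancelʳ-≡ m a b e)

<-from-values : ∀ {x y a b} → x ≡ a → y ≡ b → a < b → x < y
<-from-values x≡a y≡b = subst₂ _<_ (sym x≡a) (sym y≡b)

-- Permutations as functions on the positions 0 … N−1

DumontStep : ℕ → ℕ → Set
DumontStep x y = if evenᵇ x then y < x else x < y

step-even : ∀ {x y} → Even x → DumontStep x y → y < x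
step-even {x} {y} = subst (λ b → if b then y < x else x < y)

step-odd : ∀ {x y} → Odd x → DumontStep x y → x < y
step-odd {x} {y} = subst (λ b → if b then y < x else x < y)

even-step : ∀ {x y} → Even x → y < x → DumontStep x y
even-step {x} {y} even = subst (λ b → if b then y < x else x < y) (sym even)

odd-step : ∀ {x y} → Odd x → x < y → DumontStep x y
odd-step {x} {y} odd = subst (λ b → if b then y < x else x < y) (sym odd)

DumontStepsOn : ℕ → (ℕ → ℕ) → Set
DumontStepsOn N f = ∀ {i} → suc i < N → DumontStep (f i) (f (suc i))

LastOdd : ℕ → (ℕ → ℕ) → Set
LastOdd N f = ∀ {K} → N ≡ suc K → Odd (f K)

InjectiveOn : ℕ → (ℕ → ℕ) → Set
InjectiveOn N f = ∀ {i j} → i < N → j < N → f i ≡ f j → i ≡ j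

Pattern : Set₁
Pattern = ℕ → ℕ → ℕ → ℕ → Set

Is1342 Is4213 : Pattern
Is1342 a b c d = a < d × d < b × b < c
Is4213 a b c d = c < b × b < d × d < a

Avoids : Pattern → ℕ → (ℕ → ℕ) → Set
Avoids P N f = ∀ {i j k l} → i < j → j < k → k < l → l < N → ¬ P (f i) (f j) (f k) (f l)

record IsD¹ (N : ℕ) (f : ℕ → ℕ) : Set where
  field
    range       : ∀ {i} → i < N → 1 ≤ f i × f i ≤ N
    injective   : InjectiveOn N f
    steps       : DumontStepsOn N f
    last-odd    : LastOdd N f
    avoids-1342 : Avoids Is1342 N f
    avoids-4213 : Avoids Is4213 N f

module IsD¹Properties {N f} (D : IsD¹ N f) where
  open IsD¹ D public

  descent : ∀ {i} → suc i < N → Even (f i) → f (suc i) < f i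
  descent 1+i<N even = step-even even (steps 1+i<N)

  ascent : ∀ {i} → suc i < N → Odd (f i) → f i < f (suc i)
  ascent 1+i<N odd = step-odd odd (steps 1+i<N)

  earlier : ∀ {i L v w} → i < suc L → f i ≡ v → f L ≡ w → v ≢ w → i < L
  earlier i<1+L fi≡v fL≡w v≢w =
    ≤∧≢⇒< (s≤s⁻¹ i<1+L) λ { refl → v≢w (trans (sym fi≡v) fL≡w) }

  position : ∀ {v} → 1 ≤ v → v ≤ N → ∃[ i ] i < N × f i ≡ v
  position {v} 1≤v v≤N with anyUpTo? (λ i → f i ≟ v) N
  ... | yes found  = found
  ... | no missing = ⊥-elim (<-irrefl refl (injective⇒≤ h-injective))
    where
    index : ∀ {x} → 1 ≤ x → x ≤ N → Fin N
    index {suc x} _ x<N = fromℕ< x<N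

    index-injective : ∀ {x y} (1≤x : 1 ≤ x) x≤N (1≤y : 1 ≤ y) y≤N →
                      index 1≤x x≤N ≡ index 1≤y y≤N → x ≡ y
    index-injective {suc x} {suc y} _ x<N _ y<N eq = cong suc (fromℕ<-injective x y x<N y<N eq)

    h : Fin (suc N) → Fin N
    h fzero    = index 1≤v v≤N
    h (fsuc i) = index (proj₁ (range (toℕ<n i))) (proj₂ (range (toℕ<n i)))

    h-injective : Injective _≡_ _≡_ h
    h-injective {fzero}  {fzero}  _  = refl
    h-injective {fzero}  {fsuc j} eq = ⊥-elim (missing (toℕ j , toℕ<n j , sym (index-injective _ _ _ _ eq)))
    h-injective {fsuc i} {fzero}  eq = ⊥-elim (missing (toℕ i , toℕ<n i , index-injective _ _ _ _ eq))
    h-injective {fsuc i} {fsuc j} eq =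
      cong fsuc (toℕ-injective (injective (toℕ<n i) (toℕ<n j) (index-injective _ _ _ _ eq)))

  after-two : ∀ {i} → suc i < N → f i ≡ 2 → f (suc i) ≡ 1
  after-two {i} 1+i<N fi≡2 =
    ≤-antisym (s≤s⁻¹ (subst (f (suc i) <_) fi≡2 (descent 1+i<N (cong evenᵇ fi≡2))))
              (proj₁ (range 1+i<N))

  no-sandwich : ∀ {L pe po} → L < N → pe < L → po < L → Even (f pe) → Odd (f po) →
                f pe < f L → f L < f po → ⊥
  no-sandwich {L} {pe} {po} L<N pe<L po<L even-pe odd-po fpe<fL fL<fpo = by-order (<-cmp pe po)
    where
    po↑ : f po < f (suc po)
    po↑ = ascent (≤-<-trans po<L L<N) odd-po
    pe↓ : f (suc pe) < f pe
    pe↓ = descent (≤-<-trans pe<L L<N) even-pe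
    1+po<L : suc po < L
    1+po<L = ≤∧≢⇒< po<L λ { refl → <-asym fL<fpo po↑ }
    1+pe<L : suc pe < L
    1+pe<L = ≤∧≢⇒< pe<L λ { refl → <-asym fpe<fL pe↓ }
    by-order : Tri (pe < po) (pe ≡ po) (pe > po) → ⊥
    by-order (tri< pe<po _ _) = avoids-1342 pe<po (n<1+n po) 1+po<L L<N (fpe<fL , fL<fpo , po↑)
    by-order (tri≈ _ refl _)  = even⇒¬odd {f pe} even-pe odd-po
    by-order (tri> _ _ po<pe) = avoids-4213 po<pe (n<1+n pe) 1+pe<L L<N (pe↓ , fpe<fL , fL<fpo)

-- The last block

module _ {m f} (D : IsD¹ (6 + m) f) (even-m : Even m)
         (fK : f (4 + m) ≡ 3 + m) (fL : f (5 + m) ≡ 5 + m) where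
  private
    open IsD¹Properties D

    K<N : 4 + m < 6 + m
    K<N = +-monoˡ-< m (from-yes (4 <? 6))

    before-K : ∀ {i v} → i < 6 + m → f i ≡ v → v ≢ 5 + m → v ≢ 3 + m → i < 4 + m
    before-K i<N fi≡v v≢5+m v≢3+m = earlier (earlier i<N fi≡v fL v≢5+m) fi≡v fK v≢3+m

    distinct : ∀ {i j a b} → f i ≡ a → f j ≡ b → a ≢ b → i ≢ j
    distinct fi≡a fj≡b a≢b i≡j = a≢b (trans (sym fi≡a) (trans (cong f i≡j) fj≡b))

    two-then-one : ∀ {p} → p < 6 + m → f p ≡ 2 → suc p < 4 + m × f (suc p) ≡ 1
    two-then-one p<N fp≡2 = before-K (≤-<-trans p<K K<N) f[1+p]≡1 (λ ()) (λ ()) , f[1+p]≡1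
      where
      p<K      = before-K p<N fp≡2 (λ ()) (λ ())
      f[1+p]≡1 = after-two (≤-<-trans p<K K<N) fp≡2

    no-large-before-21 : ∀ {p t v} → suc p < 4 + m → f p ≡ 2 → f (suc p) ≡ 1 →
                         t < p → f t ≡ v → 3 + m < v → ⊥
    no-large-before-21 {p} 1+p<K fp≡2 f[1+p]≡1 t<p ft≡v 3+m<v = avoids-4213 t<p (n<1+n p) 1+p<K K<N
      ( <-from-values f[1+p]≡1 fp≡2 (from-yes (1 <? 2))
      , <-from-values fp≡2 fK (+-monoʳ-< 2 (s≤s z≤n))
      , <-from-values fK ft≡v 3+m<v )

    no-N-2-and-N-after-1 : ∀ {o q r} → f o ≡ 1 → o < q → o < r → q < 4 + m → r < 4 + m →
                           f q ≡ 4 + m → f r ≡ 6 + m → ⊥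
    no-N-2-and-N-after-1 {o} {q} {r} fo≡1 o<q o<r q<K r<K fq≡4+m fr≡6+m with <-cmp q r
    ... | tri< q<r _ _ = avoids-1342 o<q q<r r<K K<N
      ( <-from-values fo≡1 fK (s≤s (s≤s z≤n))
      , <-from-values fK fq≡4+m (n<1+n _)
      , <-from-values fq≡4+m fr≡6+m (+-monoˡ-< m (from-yes (4 <? 6))) )
    ... | tri≈ _ q≡r _ = distinct fq≡4+m fr≡6+m (shift-≢ 4 6 λ ()) q≡r
    ... | tri> _ _ r<q = avoids-4213 r<q (n<1+n q) (s≤s q<K) (n<1+n _)
      ( descent (≤-<-trans q<K K<N) (subst Even (sym fq≡4+m) even-m)
      , <-from-values fq≡4+m fL (n<1+n _)
      , <-from-values fL fr≡6+m (n<1+n _) )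

  no-penultimate-N-3 : ⊥
  no-penultimate-N-3
    with p , p<N , fp≡2   ← position {2} (s≤s z≤n) (m≤m+n 2 (4 + m))
       | q , q<N , fq≡4+m ← position {4 + m} (s≤s z≤n) (m≤n+m (4 + m) 2)
       | r , r<N , fr≡6+m ← position {6 + m} (s≤s z≤n) ≤-refl
    with 1+p<K , f[1+p]≡1 ← two-then-one p<N fp≡2
    with <-cmp q p | <-cmp r p
  ... | tri< q<p _ _ | _            = no-large-before-21 1+p<K fp≡2 f[1+p]≡1 q<p fq≡4+m (n<1+n _)
  ... | tri≈ _ q≡p _ | _            = distinct fq≡4+m fp≡2 (λ ()) q≡p
  ... | tri> _ _ p<q | tri< r<p _ _ = no-large-before-21 1+p<K fp≡2 f[1+p]≡1 r<p fr≡6+m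
                                        (+-monoˡ-< m (from-yes (3 <? 6)))
  ... | tri> _ _ p<q | tri≈ _ r≡p _ = distinct fr≡6+m fp≡2 (λ ()) r≡p
  ... | tri> _ _ p<q | tri> _ _ p<r = no-N-2-and-N-after-1 f[1+p]≡1
    (≤∧≢⇒< p<q (distinct f[1+p]≡1 fq≡4+m (λ ())))
    (≤∧≢⇒< p<r (distinct f[1+p]≡1 fr≡6+m (λ ())))
    (before-K q<N fq≡4+m (shift-≢ 4 5 λ ()) (shift-≢ 4 3 λ ()))
    (before-K r<N fr≡6+m (shift-≢ 6 5 λ ()) (shift-≢ 6 3 λ ()))
    fq≡4+m fr≡6+m

module LastBlock {K f} (D : IsD¹ (2 + K) f) (even-K : Even K) where
  open IsD¹Properties D

  K<N : K < 2 + K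
  K<N = m<n⇒m<1+n (n<1+n K)

  K≤N : K ≤ 2 + K
  K≤N = m≤n+m K 2

  no-odd-sandwich : ∀ {L m pe po} → L < 2 + K → f L ≡ 3 + m → Even m →
                    pe < L → f pe ≡ 2 + m → po < L → f po ≡ 5 + m → ⊥
  no-odd-sandwich {m = m} L<N fL≡3+m even-m pe<L fpe po<L fpo =
    no-sandwich L<N pe<L po<L (subst Even (sym fpe) even-m) (subst Odd (sym fpo) (even⇒odd-suc {m} even-m))
      (<-from-values fpe fL≡3+m ≤-refl) (<-from-values fL≡3+m fpo (+-monoˡ-< m (from-yes (3 <? 5))))

  last≡1∨last≡1+K : f (suc K) ≡ 1 ⊎ f (suc K) ≡ suc K
  last≡1∨last≡1+K with f (suc K) in fL | last-odd refl | proj₂ (range ≤-refl)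
  ... | 1                 | _   | _   = inj₁ refl
  ... | suc (suc (suc m)) | odd | x≤N with 5 + m ≤? 2 + K
  ...   | no 5+m≰N  = inj₂ (suc-injective (odd-near-even⇒pred odd even-K x≤N (s≤s⁻¹ (≰⇒> 5+m≰N))))
  ...   | yes 5+m≤N
    with pe , pe<N , fpe ← position {2 + m} (s≤s z≤n) (≤-trans (m≤n+m (2 + m) 3) 5+m≤N)
       | po , po<N , fpo ← position {5 + m} (s≤s z≤n) 5+m≤N
    = ⊥-elim (no-odd-sandwich ≤-refl fL (odd-suc⇒even {2 + m} odd)
               (earlier pe<N fpe fL (shift-≢ 2 3 λ ())) fpe (earlier po<N fpo fL (shift-≢ 5 3 λ ())) fpo)

  last≡1⇒penultimate≡2 : f (suc K) ≡ 1 → f K ≡ 2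
  last≡1⇒penultimate≡2 fL≡1 with p , p<N , fp≡2 ← position {2} (s≤s z≤n) (s≤s (s≤s z≤n)) =
    subst (λ i → f i ≡ 2) (suc-injective 1+p≡1+K) fp≡2
    where
    1+p<N : suc p < 2 + K
    1+p<N = s≤s (earlier p<N fp≡2 fL≡1 λ ())
    1+p≡1+K : suc p ≡ suc K
    1+p≡1+K = injective 1+p<N ≤-refl (trans (after-two 1+p<N fp≡2) (sym fL≡1))

  no-penultimate-1 : f (suc K) ≡ suc K → f K ≡ 1 → 0 < K → ⊥
  no-penultimate-1 fL fK≡1 0<K
    with p , p<N , fp≡2 ← position {2} (s≤s z≤n) (s≤s (s≤s z≤n))
       | q , q<N , fq≡2+K ← position {2 + K} (s≤s z≤n) ≤-refl
    = avoids-4213 q<p p<K (n<1+n K) ≤-refl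
        (<-from-values fK≡1 fp≡2 ≤-refl , <-from-values fp≡2 fL 2<1+K , <-from-values fL fq≡2+K ≤-refl)
    where
    2<1+K : 2 < suc K
    2<1+K = s≤s (even-pos⇒≥2 even-K 0<K)
    p<1+K : p < suc K
    p<1+K = earlier p<N fp≡2 fL (<⇒≢ 2<1+K)
    1+p≡K : suc p ≡ K
    1+p≡K = injective (s≤s p<1+K) K<N (trans (after-two (s≤s p<1+K) fp≡2) (sym fK≡1))
    p<K : p < K
    p<K = subst (p <_) 1+p≡K (n<1+n p)
    q<K : q < K
    q<K = earlier (earlier q<N fq≡2+K fL 1+n≢n) fq≡2+K fK≡1 λ ()
    q<p : q < p
    q<p = ≤∧≢⇒< (s≤s⁻¹ (subst (q <_) (sym 1+p≡K) q<K))
                λ { refl → <⇒≢ (+-monoʳ-< 2 0<K) (trans (sym fp≡2) fq≡2+K) }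

  no-sandwiched-penultimate : ∀ {m} → f (suc K) ≡ suc K → f K ≡ 3 + m → Even m → 5 + m ≤ K → ⊥
  no-sandwiched-penultimate {m} fL fK even-m 5+m≤K
    with pe , pe<N , fpe ← position {2 + m} (s≤s z≤n) (≤-trans (m≤n+m (2 + m) 3) (≤-trans 5+m≤K K≤N))
       | po , po<N , fpo ← position {5 + m} (s≤s z≤n) (≤-trans 5+m≤K K≤N)
    = no-odd-sandwich K<N fK even-m
        (before-K pe<N fpe (<⇒≢ (s≤s 2+m≤K)) (shift-≢ 2 3 λ ())) fpe
        (before-K po<N fpo (<⇒≢ (s≤s 5+m≤K)) (shift-≢ 5 3 λ ())) fpo
    where
    2+m≤K : 2 + m ≤ K
    2+m≤K = ≤-trans (m≤n+m (2 + m) 3) 5+m≤K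
    before-K : ∀ {i v} → i < 2 + K → f i ≡ v → v ≢ suc K → v ≢ 3 + m → i < K
    before-K i<N fi≡v v≢1+K v≢3+m = earlier (earlier i<N fi≡v fL v≢1+K) fi≡v fK v≢3+m

  no-odd-penultimate : f (suc K) ≡ suc K → f K < suc K → Odd (f K) → ⊥
  no-odd-penultimate fL fK<1+K odd with f K in fK
  no-odd-penultimate fL fK<1+K ()  | 0
  no-odd-penultimate fL fK<1+K _   | 1 = no-penultimate-1 fL fK (s≤s⁻¹ fK<1+K)
  no-odd-penultimate fL fK<1+K ()  | 2
  no-odd-penultimate fL fK<1+K odd | suc (suc (suc m)) with 5 + m ≤? K
  ... | yes 5+m≤K = no-sandwiched-penultimate fL fK (odd-suc⇒even {2 + m} odd) 5+m≤K
  ... | no  5+m≰K = no-penultimate-N-3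
    (subst (λ k → IsD¹ (2 + k) f) (sym 4+m≡K) D) (odd-suc⇒even {2 + m} odd)
    (subst (λ k → f k ≡ 3 + m) (sym 4+m≡K) fK) (subst (λ k → f (suc k) ≡ suc k) (sym 4+m≡K) fL)
    where
    4+m≡K : 4 + m ≡ K
    4+m≡K = odd-near-even⇒pred odd even-K (s≤s⁻¹ fK<1+K) (s≤s⁻¹ (≰⇒> 5+m≰K))

  last≡1+K⇒penultimate≡2+K : f (suc K) ≡ suc K → f K ≡ 2 + K
  last≡1+K⇒penultimate≡2+K fL with even-or-odd (f K)
  ... | inj₁ even = ≤-antisym (proj₂ (range K<N)) (subst (_< f K) fL (descent ≤-refl even))
  ... | inj₂ odd  = ⊥-elim (no-odd-penultimate fL (subst (f K <_) fL (ascent ≤-refl odd)) odd)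

  last≢1⇒top-block : f (suc K) ≢ 1 → f K ≡ 2 + K × f (suc K) ≡ suc K
  last≢1⇒top-block last≢1 with last≡1∨last≡1+K
  ... | inj₁ last≡1   = ⊥-elim (last≢1 last≡1)
  ... | inj₂ last≡1+K = last≡1+K⇒penultimate≡2+K last≡1+K , last≡1+K

-- Adding and removing the last block

AgreeOn : ℕ → (ℕ → ℕ) → (ℕ → ℕ) → Set
AgreeOn N g f = ∀ {i} → i < N → g i ≡ f i

record Complement (M N : ℕ) (f g : ℕ → ℕ) : Set where
  constructor complementary
  field
    sum≡ : ∀ {i} → i < N → f i + g i ≡ M

open Complement public

transport : ∀ (P : Pattern) {a b c d a′ b′ c′ d′} →
            a ≡ a′ → b ≡ b′ → c ≡ c′ → d ≡ d′ → P a b c d → P a′ b′ c′ d′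
transport P refl refl refl refl occurrence = occurrence

injective-restrict : ∀ {M N f g} → N ≤ M → AgreeOn N g f → InjectiveOn M f → InjectiveOn N g
injective-restrict N≤M g≐f injective i<N j<N gi≡gj =
  injective (<-≤-trans i<N N≤M) (<-≤-trans j<N N≤M) (trans (sym (g≐f i<N)) (trans gi≡gj (g≐f j<N)))

steps-restrict : ∀ {M N f g} → N ≤ M → AgreeOn N g f → DumontStepsOn M f → DumontStepsOn N g
steps-restrict N≤M g≐f steps {i} 1+i<N =
  subst₂ DumontStep (sym (g≐f (<-trans (n<1+n i) 1+i<N))) (sym (g≐f 1+i<N))
                    (steps (<-≤-trans 1+i<N N≤M))

avoids-restrict : ∀ P {M N f g} → N ≤ M → AgreeOn N g f → Avoids P M f → Avoids P N g
avoids-restrict P N≤M g≐f avoids i<j j<k k<l l<N occurrence =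
  avoids i<j j<k k<l (<-≤-trans l<N N≤M)
    (transport P (g≐f i<N) (g≐f j<N) (g≐f k<N) (g≐f l<N) occurrence)
  where
  k<N = <-trans k<l l<N
  j<N = <-trans j<k k<N
  i<N = <-trans i<j j<N

complement-sym : ∀ {M N f g} → Complement M N f g → Complement M N g f
complement-sym {f = f} {g} c = complementary λ {i} i<N → trans (+-comm (g i) (f i)) (sum≡ c i<N)

complement-< : ∀ {M N f g i j} → Complement M N f g → i < N → j < N → g i < g j → f j < f i
complement-< c i<N j<N gi<gj =
  ≰⇒> λ fi≤fj → <-irrefl (trans (sum≡ c i<N) (sym (sum≡ c j<N))) (+-mono-≤-< fi≤fj gi<gj)

complement-injective : ∀ {M N f g} → Complement M N f g → InjectiveOn N g → InjectiveOn N f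
complement-injective {f = f} {g} c injective {i} {j} i<N j<N fi≡fj =
  injective i<N j<N (+-cancelˡ-≡ (f i) (g i) (g j) (begin
    f i + g i  ≡⟨ sum≡ c i<N ⟩
    _          ≡⟨ sum≡ c j<N ⟨
    f j + g j  ≡⟨ cong (_+ g j) fi≡fj ⟨
    f i + g j  ∎))
  where open ≡-Reasoning

complement-parity : ∀ {M N f g i} → Odd M → Complement M N f g → i < N →
                    evenᵇ (f i) ≡ not (evenᵇ (g i))
complement-parity {f = f} {g} {i} odd-M c i<N =
  odd-sum⇒opposite-parity (g i) (f i) (subst Odd (sym (sum≡ (complement-sym c) i<N)) odd-M)

complement-steps : ∀ {M N f g} → Odd M → Complement M N f g →
                   DumontStepsOn N g → DumontStepsOn N f
complement-steps {g = g} odd-M c steps {i} 1+i<N with evenᵇ (g i) in parity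
... | true  = odd-step  (trans (complement-parity odd-M c i<N) (cong not parity))
                        (complement-< c 1+i<N i<N (step-even parity (steps 1+i<N)))
  where i<N = <-trans (n<1+n i) 1+i<N
... | false = even-step (trans (complement-parity odd-M c i<N) (cong not parity))
                        (complement-< c i<N 1+i<N (step-odd parity (steps 1+i<N)))
  where i<N = <-trans (n<1+n i) 1+i<N

complement-avoids-1342 : ∀ {M N f g} → Complement M N f g → Avoids Is1342 N g → Avoids Is4213 N f
complement-avoids-1342 {N = N} {f} {g} c avoids i<j j<k k<l l<N (fk<fj , fj<fl , fl<fi) =
  avoids i<j j<k k<l l<N (flip i<N l<N fl<fi , flip l<N j<N fj<fl , flip j<N k<N fk<fj)
  where
  flip : ∀ {a b} → a < N → b < N → f b < f a → g a < g b
  flip a<N b<N = complement-< (complement-sym c) b<N a<N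
  k<N = <-trans k<l l<N
  j<N = <-trans j<k k<N
  i<N = <-trans i<j j<N

complement-avoids-4213 : ∀ {M N f g} → Complement M N f g → Avoids Is4213 N g → Avoids Is1342 N f
complement-avoids-4213 {N = N} {f} {g} c avoids i<j j<k k<l l<N (fi<fl , fl<fj , fj<fk) =
  avoids i<j j<k k<l l<N (flip j<N k<N fj<fk , flip l<N j<N fl<fj , flip i<N l<N fi<fl)
  where
  flip : ∀ {a b} → a < N → b < N → f a < f b → g b < g a
  flip a<N b<N = complement-< (complement-sym c) a<N b<N
  k<N = <-trans k<l l<N
  j<N = <-trans j<k k<N
  i<N = <-trans i<j j<N

complement-range : ∀ {a b N} → a + b ≡ 3 + N → 1 ≤ b → b ≤ N → 3 ≤ a × a ≤ 2 + N
complement-range {a} {b} {N} a+b≡3+N 1≤b b≤N =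
  +-cancelʳ-≤ N 3 a (subst (_≤ a + N) a+b≡3+N (+-monoʳ-≤ a b≤N)) ,
  s≤s⁻¹ (subst (a <_) a+b≡3+N (m<m+n a 1≤b))

complement-range⁻ : ∀ {a b N} → a + b ≡ 3 + N → 3 ≤ a → a ≤ 2 + N → 1 ≤ b × b ≤ N
complement-range⁻ {a} {b} {N} a+b≡3+N 3≤a a≤2+N =
  n≢0⇒n>0 (λ { refl → <-irrefl refl (subst (_≤ 2 + N) (trans (sym (+-identityʳ a)) a+b≡3+N) a≤2+N) }) ,
  +-cancelˡ-≤ 3 b N (subst (3 + b ≤_) a+b≡3+N (+-monoˡ-≤ b 3≤a))

injective-snoc : ∀ {M f} → InjectiveOn M f → (∀ {i} → i < M → f i ≢ f M) → InjectiveOn (suc M) f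
injective-snoc injective fresh i<1+M j<1+M fi≡fj with m<1+n⇒m<n∨m≡n i<1+M | m<1+n⇒m<n∨m≡n j<1+M
... | inj₁ i<M  | inj₁ j<M  = injective i<M j<M fi≡fj
... | inj₁ i<M  | inj₂ refl = ⊥-elim (fresh i<M fi≡fj)
... | inj₂ refl | inj₁ j<M  = ⊥-elim (fresh j<M (sym fi≡fj))
... | inj₂ refl | inj₂ refl = refl

steps-snoc : ∀ {M f} → DumontStepsOn M f → (∀ {K} → M ≡ suc K → DumontStep (f K) (f M)) →
             DumontStepsOn (suc M) f
steps-snoc steps seam 1+i<1+M with m<1+n⇒m<n∨m≡n 1+i<1+M
... | inj₁ 1+i<M = steps 1+i<M
... | inj₂ refl  = seam refl

AvoidsAtLastTwo : Pattern → ℕ → (ℕ → ℕ) → Set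
AvoidsAtLastTwo P N f =
  ∀ {i j k l} → i < j → j < k → k < l → N ≤ l → l < 2 + N → ¬ P (f i) (f j) (f k) (f l)

avoids-extend₂ : ∀ P {N f} → Avoids P N f → AvoidsAtLastTwo P N f → Avoids P (2 + N) f
avoids-extend₂ P {N} avoids new {l = l} i<j j<k k<l l<2+N with l <? N
... | yes l<N = avoids i<j j<k k<l l<N
... | no  l≮N = new i<j j<k k<l (≮⇒≥ l≮N) l<2+N

split-last-two : ∀ {i N} → i < 2 + N → i < N ⊎ i ≡ N ⊎ i ≡ suc N
split-last-two i<2+N with m<1+n⇒m<n∨m≡n i<2+N
... | inj₂ i≡1+N = inj₂ (inj₂ i≡1+N)
... | inj₁ i<1+N with m<1+n⇒m<n∨m≡n i<1+N
...   | inj₁ i<N = inj₁ i<N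
...   | inj₂ i≡N = inj₂ (inj₁ i≡N)

second-before-last-two : ∀ {N i j k l} → i < j → j < k → k < l → l < 2 + N → j < N
second-before-last-two i<j j<k k<l l<2+N = <-≤-trans j<k (s≤s⁻¹ (<-≤-trans k<l (s≤s⁻¹ l<2+N)))

IsD¹-appendTop : ∀ {N f g} → Even N → IsD¹ N g → AgreeOn N f g →
                 f N ≡ 2 + N → f (suc N) ≡ suc N → IsD¹ (2 + N) f
IsD¹-appendTop {N} {f} {g} even-N D f≐g fN fN+1 = record
  { range       = range
  ; injective   = injective-snoc (injective-snoc (injective-restrict ≤-refl f≐g D.injective)
                                   λ i<N → <⇒≢ (old<new i<N ≤-refl N<2+N))
                                 fresh-N+1
  ; steps       = steps-snoc (steps-snoc (steps-restrict ≤-refl f≐g D.steps) seam)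
                    λ { refl → even-step (subst Even (sym fN) even-N) (<-from-values fN+1 fN ≤-refl) }
  ; last-odd    = λ { refl → subst Odd (sym fN+1) (even⇒odd-suc {N} even-N) }
  ; avoids-1342 = avoids-extend₂ Is1342 (avoids-restrict Is1342 ≤-refl f≐g D.avoids-1342) new-1342
  ; avoids-4213 = avoids-extend₂ Is4213 (avoids-restrict Is4213 ≤-refl f≐g D.avoids-4213) new-4213
  }
  where
  module D = IsD¹ D
  N<2+N : N < 2 + N
  N<2+N = m<n⇒m<1+n (n<1+n N)
  old≤N : ∀ {i} → i < N → f i ≤ N
  old≤N i<N = subst (_≤ N) (sym (f≐g i<N)) (proj₂ (D.range i<N))
  old<new : ∀ {i l} → i < N → N ≤ l → l < 2 + N → f i < f l
  old<new {i} i<N N≤l l<2+N with split-last-two l<2+N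
  ... | inj₁ l<N         = ⊥-elim (<-irrefl refl (<-≤-trans l<N N≤l))
  ... | inj₂ (inj₁ refl) = subst (f i <_) (sym fN) (≤-trans (s≤s (old≤N i<N)) (n≤1+n _))
  ... | inj₂ (inj₂ refl) = subst (f i <_) (sym fN+1) (s≤s (old≤N i<N))
  fresh-N+1 : ∀ {i} → i < suc N → f i ≢ f (suc N)
  fresh-N+1 i<1+N with m<1+n⇒m<n∨m≡n i<1+N
  ... | inj₁ i<N  = <⇒≢ (old<new i<N (n≤1+n N) ≤-refl)
  ... | inj₂ refl = >⇒≢ (<-from-values fN+1 fN ≤-refl)
  range : ∀ {i} → i < 2 + N → 1 ≤ f i × f i ≤ 2 + N
  range i<2+N with split-last-two i<2+N
  ... | inj₁ i<N         = subst (λ v → 1 ≤ v × v ≤ 2 + N) (sym (f≐g i<N))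
                                 (proj₁ (D.range i<N) , m≤n⇒m≤o+n 2 (proj₂ (D.range i<N)))
  ... | inj₂ (inj₁ refl) = subst (λ v → 1 ≤ v × v ≤ 2 + N) (sym fN) (s≤s z≤n , ≤-refl)
  ... | inj₂ (inj₂ refl) = subst (λ v → 1 ≤ v × v ≤ 2 + N) (sym fN+1) (s≤s z≤n , n≤1+n _)
  seam : ∀ {K} → N ≡ suc K → DumontStep (f K) (f N)
  seam {K} refl = odd-step (subst Odd (sym (f≐g K<N)) (D.last-odd refl)) (old<new K<N ≤-refl N<2+N)
    where K<N = n<1+n K
  new-1342 : AvoidsAtLastTwo Is1342 N f
  new-1342 i<j j<k k<l N≤l l<2+N (_ , fl<fj , _) =
    <-asym fl<fj (old<new (second-before-last-two i<j j<k k<l l<2+N) N≤l l<2+N)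
  new-4213 : AvoidsAtLastTwo Is4213 N f
  new-4213 i<j j<k k<l N≤l l<2+N (_ , _ , fl<fi) =
    <-asym fl<fi (old<new (<-trans i<j (second-before-last-two i<j j<k k<l l<2+N)) N≤l l<2+N)

IsD¹-appendBottom : ∀ {N f g} → Even N → IsD¹ N g → Complement (3 + N) N f g →
                    f N ≡ 2 → f (suc N) ≡ 1 → IsD¹ (2 + N) f
IsD¹-appendBottom {N} {f} {g} even-N D f+g≡3+N fN fN+1 = record
  { range       = range
  ; injective   = injective-snoc (injective-snoc (complement-injective f+g≡3+N D.injective)
                                   λ i<N → >⇒≢ (new<old i<N ≤-refl N<2+N))
                                 fresh-N+1
  ; steps       = steps-snoc (steps-snoc (complement-steps odd-3+N f+g≡3+N D.steps) seam)
                    λ { refl → even-step (subst Even (sym fN) refl) (<-from-values fN+1 fN ≤-refl) }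
  ; last-odd    = λ { refl → subst Odd (sym fN+1) refl }
  ; avoids-1342 = avoids-extend₂ Is1342 (complement-avoids-4213 f+g≡3+N D.avoids-4213) new-1342
  ; avoids-4213 = avoids-extend₂ Is4213 (complement-avoids-1342 f+g≡3+N D.avoids-1342) new-4213
  }
  where
  module D = IsD¹ D
  N<2+N : N < 2 + N
  N<2+N = m<n⇒m<1+n (n<1+n N)
  odd-3+N : Odd (3 + N)
  odd-3+N = even⇒odd-suc {N} even-N
  old-range : ∀ {i} → i < N → 3 ≤ f i × f i ≤ 2 + N
  old-range i<N = complement-range (sum≡ f+g≡3+N i<N) (proj₁ (D.range i<N)) (proj₂ (D.range i<N))
  new<old : ∀ {i l} → i < N → N ≤ l → l < 2 + N → f l < f i
  new<old {i} i<N N≤l l<2+N with split-last-two l<2+N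
  ... | inj₁ l<N         = ⊥-elim (<-irrefl refl (<-≤-trans l<N N≤l))
  ... | inj₂ (inj₁ refl) = subst (_< f i) (sym fN) (proj₁ (old-range i<N))
  ... | inj₂ (inj₂ refl) = subst (_< f i) (sym fN+1) (≤-trans (s≤s (s≤s z≤n)) (proj₁ (old-range i<N)))
  fresh-N+1 : ∀ {i} → i < suc N → f i ≢ f (suc N)
  fresh-N+1 i<1+N with m<1+n⇒m<n∨m≡n i<1+N
  ... | inj₁ i<N  = >⇒≢ (new<old i<N (n≤1+n N) ≤-refl)
  ... | inj₂ refl = >⇒≢ (<-from-values fN+1 fN ≤-refl)
  range : ∀ {i} → i < 2 + N → 1 ≤ f i × f i ≤ 2 + N
  range i<2+N with split-last-two i<2+N
  ... | inj₁ i<N         = ≤-trans (s≤s z≤n) (proj₁ (old-range i<N)) , proj₂ (old-range i<N)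
  ... | inj₂ (inj₁ refl) = subst (λ v → 1 ≤ v × v ≤ 2 + N) (sym fN) (s≤s z≤n , s≤s (s≤s z≤n))
  ... | inj₂ (inj₂ refl) = subst (λ v → 1 ≤ v × v ≤ 2 + N) (sym fN+1) (s≤s z≤n , s≤s z≤n)
  seam : ∀ {K} → N ≡ suc K → DumontStep (f K) (f N)
  seam {K} refl = even-step (trans (complement-parity odd-3+N f+g≡3+N K<N) (cong not (D.last-odd refl)))
                            (new<old K<N ≤-refl N<2+N)
    where K<N = n<1+n K
  new-1342 : AvoidsAtLastTwo Is1342 N f
  new-1342 i<j j<k k<l N≤l l<2+N (fi<fl , _ , _) =
    <-asym fi<fl (new<old (<-trans i<j (second-before-last-two i<j j<k k<l l<2+N)) N≤l l<2+N)
  new-4213 : AvoidsAtLastTwo Is4213 N f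
  new-4213 i<j j<k k<l N≤l l<2+N (_ , fj<fl , _) =
    <-asym fj<fl (new<old (second-before-last-two i<j j<k k<l l<2+N) N≤l l<2+N)

module _ {N f} (D : IsD¹ (2 + N) f) where
  private
    module D = IsD¹ D

    N≤2+N : N ≤ 2 + N
    N≤2+N = m≤n+m N 2

    fresh-below : ∀ {i v w} → i < N → f i ≡ v → f w ≡ v → N ≤ w → w < 2 + N → ⊥
    fresh-below i<N fi≡v fw≡v N≤w w<2+N =
      <-irrefl (D.injective (<-≤-trans i<N N≤2+N) w<2+N (trans fi≡v (sym fw≡v))) (<-≤-trans i<N N≤w)

  IsD¹-removeTop : ∀ {g} → f N ≡ 2 + N → f (suc N) ≡ suc N → AgreeOn N g f → IsD¹ N g
  IsD¹-removeTop {g} fN fN+1 g≐f = record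
    { range       = λ i<N → subst (λ v → 1 ≤ v × v ≤ N) (sym (g≐f i<N))
                                  (proj₁ (D.range (<-≤-trans i<N N≤2+N)) , below-top i<N)
    ; injective   = injective-restrict N≤2+N g≐f D.injective
    ; steps       = steps-restrict N≤2+N g≐f D.steps
    ; last-odd    = last-odd
    ; avoids-1342 = avoids-restrict Is1342 N≤2+N g≐f D.avoids-1342
    ; avoids-4213 = avoids-restrict Is4213 N≤2+N g≐f D.avoids-4213
    }
    where
    below-top : ∀ {i} → i < N → f i ≤ N
    below-top {i} i<N = s≤s⁻¹ (≤∧≢⇒< (s≤s⁻¹ (≤∧≢⇒< fi≤2+N fi≢2+N)) fi≢1+N)
      where
      fi≤2+N = proj₂ (D.range (<-≤-trans i<N N≤2+N))
      fi≢2+N = λ fi≡2+N → fresh-below i<N fi≡2+N fN ≤-refl (m<n⇒m<1+n (n<1+n N))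
      fi≢1+N = λ fi≡1+N → fresh-below i<N fi≡1+N fN+1 (n≤1+n N) ≤-refl
    last-odd : LastOdd N g
    last-odd {K} refl with even-or-odd (f K)
    ... | inj₂ odd  = subst Odd (sym (g≐f (n<1+n K))) odd
    ... | inj₁ even = ⊥-elim (<-irrefl refl (≤-<-trans (proj₂ (D.range (<-≤-trans (n<1+n K) N≤2+N)))
                        (subst (_< f K) fN (step-even even (D.steps (m<n⇒m<1+n (n<1+n N)))))))

  IsD¹-removeBottom : ∀ {g} → Even N → f N ≡ 2 → f (suc N) ≡ 1 →
                      Complement (3 + N) N f g → IsD¹ N g
  IsD¹-removeBottom {g} even-N fN fN+1 f+g≡3+N = record
    { range       = λ i<N → complement-range⁻ (sum≡ f+g≡3+N i<N) (above-bottom i<N)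
                                               (proj₂ (D.range (<-≤-trans i<N N≤2+N)))
    ; injective   = complement-injective g+f≡3+N (injective-restrict N≤2+N (λ _ → refl) D.injective)
    ; steps       = complement-steps odd-3+N g+f≡3+N (steps-restrict N≤2+N (λ _ → refl) D.steps)
    ; last-odd    = last-odd
    ; avoids-1342 = complement-avoids-4213 g+f≡3+N (avoids-restrict Is4213 N≤2+N (λ _ → refl) D.avoids-4213)
    ; avoids-4213 = complement-avoids-1342 g+f≡3+N (avoids-restrict Is1342 N≤2+N (λ _ → refl) D.avoids-1342)
    }
    where
    odd-3+N : Odd (3 + N)
    odd-3+N = even⇒odd-suc {N} even-N
    g+f≡3+N : Complement (3 + N) N g f
    g+f≡3+N = complement-sym f+g≡3+N
    above-bottom : ∀ {i} → i < N → 3 ≤ f i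
    above-bottom {i} i<N = ≤∧≢⇒< (≤∧≢⇒< (proj₁ (D.range (<-≤-trans i<N N≤2+N)))
                             λ 1≡fi → fresh-below i<N (sym 1≡fi) fN+1 (n≤1+n N) ≤-refl)
                             λ 2≡fi → fresh-below i<N (sym 2≡fi) fN ≤-refl (m<n⇒m<1+n (n<1+n N))
    last-odd : LastOdd N g
    last-odd {K} refl with even-or-odd (f K)
    ... | inj₁ even = trans (complement-parity odd-3+N g+f≡3+N (n<1+n K)) (cong not even)
    ... | inj₂ odd  = ⊥-elim (fresh-below (n<1+n K) fK≡1 fN+1 (n≤1+n N) ≤-refl)
      where
      fK≡1 : f K ≡ 1
      fK≡1 = ≤-antisym (s≤s⁻¹ (subst (f K <_) fN (step-odd odd (D.steps (m<n⇒m<1+n (n<1+n N))))))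
                       (proj₁ (D.range (<-≤-trans (n<1+n K) N≤2+N)))

-- The Boolean definitions

at : List ℕ → ℕ → ℕ
at []       _       = 0
at (x ∷ xs) zero    = x
at (x ∷ xs) (suc i) = at xs i

All⇔at : ∀ {P : ℕ → Set} {l} → All P l ⇔ (∀ {i} → i < length l → P (at l i))
All⇔at = mk⇔ to from
  where
  to : ∀ {P : ℕ → Set} {l} → All P l → ∀ {i} → i < length l → P (at l i)
  to (px ∷ _)   {zero}  _       = px
  to (_  ∷ pxs) {suc i} 1+i<len = to pxs (s≤s⁻¹ 1+i<len)
  from : ∀ {P : ℕ → Set} {l} → (∀ {i} → i < length l → P (at l i)) → All P l
  from {l = []}    _ = []
  from {l = _ ∷ _} p = p (s≤s z≤n) ∷ from (p ∘ s≤s)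

∧⁻ : ∀ a {b} → T (a ∧ b) → T a × T b
∧⁻ a = Equivalence.to (T-∧ {a})

∧⁺ : ∀ {a b} → T a → T b → T (a ∧ b)
∧⁺ ta tb = Equivalence.from T-∧ (ta , tb)

T-not : ∀ {b} → T (not b) ⇔ (¬ T b)
T-not {true}  = mk⇔ (λ ()) (λ ¬true → ¬true tt)
T-not {false} = mk⇔ (λ _ ()) (λ _ → tt)

inRangeᵇ : ℕ → ℕ → Bool
inRangeᵇ N x = (1 ≤ᵇ x) ∧ (x ≤ᵇ N)

inRange⇔ : ∀ {N x} → T (inRangeᵇ N x) ⇔ (1 ≤ x × x ≤ N)
inRange⇔ {N} {x} = mk⇔
  (λ h → ≤ᵇ⇒≤ 1 x (proj₁ (∧⁻ (1 ≤ᵇ x) h)) , ≤ᵇ⇒≤ x N (proj₂ (∧⁻ (1 ≤ᵇ x) h)))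
  (λ { (1≤x , x≤N) → ∧⁺ (≤⇒≤ᵇ 1≤x) (≤⇒≤ᵇ x≤N) })

range⇔ : ∀ {N} l → T (all (inRangeᵇ N) l) ⇔ (∀ {i} → i < length l → 1 ≤ at l i × at l i ≤ N)
range⇔ {N} l = mk⇔
  (λ h {i} i<len → Equivalence.to inRange⇔ (Equivalence.to All⇔at (all⁺ (inRangeᵇ N) l h) {i} i<len))
  (λ h → all⁻ (inRangeᵇ N) (Equivalence.from (All⇔at {l = l}) λ {i} i<len →
           Equivalence.from inRange⇔ (h {i} i<len)))

fresh⇔ : ∀ {x xs} → T (not (any (λ y → x ≡ᵇ y) xs)) ⇔ (∀ {j} → j < length xs → at xs j ≢ x)
fresh⇔ {x} {[]}     = mk⇔ (λ _ ()) (λ _ → tt)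
fresh⇔ {x} {y ∷ ys} with x ≡ᵇ y in x≡ᵇy
... | true  = mk⇔ (λ ())
                  λ fresh → fresh {0} (s≤s z≤n) (sym (≡ᵇ⇒≡ x y (Equivalence.from T-≡ x≡ᵇy)))
... | false = mk⇔ to (λ fresh → Equivalence.from (fresh⇔ {x} {ys}) (fresh ∘ s≤s))
  where
  to : T (not (any (λ y → x ≡ᵇ y) ys)) → ∀ {j} → j < length (y ∷ ys) → at (y ∷ ys) j ≢ x
  to h {zero}  _       refl = subst T x≡ᵇy (≡⇒≡ᵇ x x refl)
  to h {suc j} 1+j<len      = Equivalence.to (fresh⇔ {x} {ys}) h (s≤s⁻¹ 1+j<len)

distinct⇔ : ∀ l → T (distinctᵇ l) ⇔ InjectiveOn (length l) (at l)
distinct⇔ []       = mk⇔ (λ _ ()) (λ _ → tt)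
distinct⇔ (x ∷ xs) = mk⇔ to from
  where
  x-fresh = not (any (λ y → x ≡ᵇ y) xs)
  to : T (distinctᵇ (x ∷ xs)) → InjectiveOn (length (x ∷ xs)) (at (x ∷ xs))
  to h = injective
    where
    fresh = Equivalence.to (fresh⇔ {x} {xs}) (proj₁ (∧⁻ x-fresh h))
    rest  = Equivalence.to (distinct⇔ xs) (proj₂ (∧⁻ x-fresh h))
    injective : InjectiveOn (length (x ∷ xs)) (at (x ∷ xs))
    injective {zero}  {zero}  _       _       _ = refl
    injective {zero}  {suc j} _       1+j<len e = ⊥-elim (fresh (s≤s⁻¹ 1+j<len) (sym e))
    injective {suc i} {zero}  1+i<len _       e = ⊥-elim (fresh (s≤s⁻¹ 1+i<len) e)
    injective {suc i} {suc j} 1+i<len 1+j<len e = cong suc (rest (s≤s⁻¹ 1+i<len) (s≤s⁻¹ 1+j<len) e)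
  from : InjectiveOn (length (x ∷ xs)) (at (x ∷ xs)) → T (distinctᵇ (x ∷ xs))
  from injective = ∧⁺
    (Equivalence.from (fresh⇔ {x} {xs}) λ j<len e → case injective (s≤s z≤n) (s≤s j<len) (sym e) of λ ())
    (Equivalence.from (distinct⇔ xs) λ i<len j<len e → suc-injective (injective (s≤s i<len) (s≤s j<len) e))

step⇔ : ∀ {x y} → T (if evenᵇ x then y <ᵇ x else x <ᵇ y) ⇔ DumontStep x y
step⇔ {x} {y} with evenᵇ x
... | true  = mk⇔ (<ᵇ⇒< y x) <⇒<ᵇ
... | false = mk⇔ (<ᵇ⇒< x y) <⇒<ᵇ

DumontOn : ℕ → (ℕ → ℕ) → Set
DumontOn N f = DumontStepsOn N f × LastOdd N f

DumontOn-∷ : ∀ {x y xs} → DumontStep x y → DumontOn (length (y ∷ xs)) (at (y ∷ xs)) →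
             DumontOn (length (x ∷ y ∷ xs)) (at (x ∷ y ∷ xs))
DumontOn-∷ step (steps , last-odd) = steps′ , λ { {suc K} e → last-odd (suc-injective e) }
  where
  steps′ : DumontStepsOn _ _
  steps′ {zero}  _       = step
  steps′ {suc i} 2+i<len = steps (s≤s⁻¹ 2+i<len)

dumontᵇ⇒ : ∀ l → T (dumontᵇ l) → DumontOn (length l) (at l)
dumontᵇ⇒ []           _ = (λ ()) , λ ()
dumontᵇ⇒ (x ∷ [])     h = (λ { (s≤s ()) }) , λ { refl → Equivalence.to T-not-≡ h }
dumontᵇ⇒ (x ∷ y ∷ xs) h = DumontOn-∷ (Equivalence.to step⇔ first) (dumontᵇ⇒ (y ∷ xs) rest)
  where first-step = if evenᵇ x then y <ᵇ x else x <ᵇ y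
        first = proj₁ (∧⁻ first-step h)
        rest  = proj₂ (∧⁻ first-step h)

dumontᵇ⇐ : ∀ l → DumontOn (length l) (at l) → T (dumontᵇ l)
dumontᵇ⇐ []           _                  = tt
dumontᵇ⇐ (x ∷ [])     (_ , last-odd)     = Equivalence.from T-not-≡ (last-odd refl)
dumontᵇ⇐ (x ∷ y ∷ xs) (steps , last-odd) =
  ∧⁺ (Equivalence.from step⇔ (steps (s≤s (s≤s z≤n))))
     (dumontᵇ⇐ (y ∷ xs) ((steps ∘ s≤s) , (last-odd ∘ cong suc)))

-- The Boolean equivalence that pairsOK in Defs uses through a private local definition.
_==_ : Bool → Bool → Bool
true  == b = b
false == b = not b

T-== : ∀ {p q} → T (p == q) ⇔ p ≡ q
T-== {true}  {true}  = mk⇔ (λ _ → refl) (λ _ → tt)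
T-== {true}  {false} = mk⇔ (λ ()) (λ ())
T-== {false} {true}  = mk⇔ (λ ()) (λ ())
T-== {false} {false} = mk⇔ (λ _ → refl) (λ _ → tt)

pairsOK-∷ : ∀ x y a b as bs → pairsOK x y (a ∷ as) (b ∷ bs) ≡
            ((x <ᵇ a) == (y <ᵇ b)) ∧ ((a <ᵇ x) == (b <ᵇ y)) ∧ pairsOK x y as bs
pairsOK-∷ x y a b as bs with x <ᵇ a | a <ᵇ x
... | true  | true  = refl
... | true  | false = refl
... | false | true  = refl
... | false | false = refl

SameOrder : ℕ → ℕ → ℕ → ℕ → Set
SameOrder x a y b = (x <ᵇ a) ≡ (y <ᵇ b) × (a <ᵇ x) ≡ (b <ᵇ y)

OrderIso : List ℕ → List ℕ → Set
OrderIso []       []       = ⊤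
OrderIso (x ∷ xs) (y ∷ ys) = Pointwise (λ a b → SameOrder x a y b) xs ys × OrderIso xs ys
OrderIso _        _        = ⊥

pairsOK⇔ : ∀ {x y as bs} → T (pairsOK x y as bs) ⇔ Pointwise (λ a b → SameOrder x a y b) as bs
pairsOK⇔ {x} {y} {[]}     {[]}     = mk⇔ (λ _ → []) (λ _ → tt)
pairsOK⇔ {x} {y} {[]}     {_ ∷ _}  = mk⇔ (λ ()) (λ ())
pairsOK⇔ {x} {y} {_ ∷ _}  {[]}     = mk⇔ (λ ()) (λ ())
pairsOK⇔ {x} {y} {a ∷ as} {b ∷ bs} rewrite pairsOK-∷ x y a b as bs = mk⇔
  (λ h → let e₁ , h′ = ∧⁻ ((x <ᵇ a) == (y <ᵇ b)) h
             e₂ , h″ = ∧⁻ ((a <ᵇ x) == (b <ᵇ y)) h′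
         in (Equivalence.to T-== e₁ , Equivalence.to T-== e₂) ∷ Equivalence.to pairsOK⇔ h″)
  (λ { ((e₁ , e₂) ∷ rest) →
         ∧⁺ (Equivalence.from T-== e₁)
            (∧⁺ (Equivalence.from T-== e₂) (Equivalence.from pairsOK⇔ rest)) })

orderIso⇔ : ∀ {s t} → T (orderIso s t) ⇔ OrderIso s t
orderIso⇔ {[]}     {[]}     = mk⇔ (λ _ → tt) (λ _ → tt)
orderIso⇔ {[]}     {_ ∷ _}  = mk⇔ (λ ()) (λ ())
orderIso⇔ {_ ∷ _}  {[]}     = mk⇔ (λ ()) (λ ())
orderIso⇔ {x ∷ xs} {y ∷ ys} = mk⇔
  (λ h → let p , h′ = ∧⁻ (pairsOK x y xs ys) h
         in Equivalence.to pairsOK⇔ p , Equivalence.to orderIso⇔ h′)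
  (λ { (p , rest) → ∧⁺ (Equivalence.from pairsOK⇔ p) (Equivalence.from orderIso⇔ rest) })

<ᵇ≡true⇒< : ∀ {x y} → (x <ᵇ y) ≡ true → x < y
<ᵇ≡true⇒< {x} {y} e = <ᵇ⇒< x y (Equivalence.from T-≡ e)

<⇒ordered : ∀ {x y} → x < y → (x <ᵇ y) ≡ true × (y <ᵇ x) ≡ false
<⇒ordered {x} {y} x<y =
  Equivalence.to T-≡ (<⇒<ᵇ x<y) ,
  Equivalence.to T-not-≡ (Equivalence.from T-not λ y<x → <-asym x<y (<ᵇ⇒< y x y<x))

orderIso-1342⇔ : ∀ {a b c d} →
                 OrderIso (a ∷ b ∷ c ∷ d ∷ []) (1 ∷ 3 ∷ 4 ∷ 2 ∷ []) ⇔ Is1342 a b c d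
orderIso-1342⇔ = mk⇔
  (λ { ((_ ∷ _ ∷ (a<d , _) ∷ []) , ((b<c , _) ∷ (_ , d<b) ∷ []) , _) →
         <ᵇ≡true⇒< a<d , <ᵇ≡true⇒< d<b , <ᵇ≡true⇒< b<c })
  (λ { (a<d , d<b , b<c) →
         let a<b = <-trans a<d d<b in
         (<⇒ordered a<b ∷ <⇒ordered (<-trans a<b b<c) ∷ <⇒ordered a<d ∷ []) ,
         (<⇒ordered b<c ∷ swap (<⇒ordered d<b) ∷ []) ,
         (swap (<⇒ordered (<-trans d<b b<c)) ∷ []) , [] , tt })

orderIso-4213⇔ : ∀ {a b c d} →
                 OrderIso (a ∷ b ∷ c ∷ d ∷ []) (4 ∷ 2 ∷ 1 ∷ 3 ∷ []) ⇔ Is4213 a b c d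
orderIso-4213⇔ = mk⇔
  (λ { ((_ ∷ _ ∷ (_ , d<a) ∷ []) , ((_ , c<b) ∷ (b<d , _) ∷ []) , _) →
         <ᵇ≡true⇒< c<b , <ᵇ≡true⇒< b<d , <ᵇ≡true⇒< d<a })
  (λ { (c<b , b<d , d<a) →
         let b<a = <-trans b<d d<a in
         (swap (<⇒ordered b<a) ∷ swap (<⇒ordered (<-trans c<b b<a)) ∷ swap (<⇒ordered d<a) ∷ []) ,
         (swap (<⇒ordered c<b) ∷ <⇒ordered b<d ∷ []) ,
         (<⇒ordered (<-trans c<b b<d) ∷ []) , [] , tt })

∈-subseqs⁻ : ∀ {k s} n l → s ∈ subseqs (suc k) (drop n l) →
             ∃[ i ] ∃[ s′ ] s ≡ at l i ∷ s′ × n ≤ i × i < length l ×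
                            s′ ∈ subseqs k (drop (suc i) l)
∈-subseqs⁻ {k} zero (x ∷ xs) s∈ with ∈-++⁻ (map (x ∷_) (subseqs k xs)) s∈
... | inj₁ s∈map  with s′ , s′∈ , refl ← map∷⁻ s∈map =
  zero , s′ , refl , z≤n , s≤s z≤n , s′∈
... | inj₂ s∈rest with i , s′ , refl , _ , i<len , s′∈ ← ∈-subseqs⁻ zero xs s∈rest =
  suc i , s′ , refl , z≤n , s≤s i<len , s′∈
∈-subseqs⁻ (suc n) (x ∷ xs) s∈ with i , s′ , refl , n≤i , i<len , s′∈ ← ∈-subseqs⁻ n xs s∈ =
  suc i , s′ , refl , s≤s n≤i , s≤s i<len , s′∈

∈-subseqs⁺ : ∀ {k s} n l {i} → n ≤ i → i < length l → s ∈ subseqs k (drop (suc i) l) →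
             at l i ∷ s ∈ subseqs (suc k) (drop n l)
∈-subseqs⁺ {k} zero    (x ∷ xs) {zero}  _       _       s∈ = ∈-++⁺ˡ (∈-map⁺ (x ∷_) s∈)
∈-subseqs⁺ {k} zero    (x ∷ xs) {suc i} _       1+i<len s∈ =
  ∈-++⁺ʳ (map (x ∷_) (subseqs k xs)) (∈-subseqs⁺ zero xs z≤n (s≤s⁻¹ 1+i<len) s∈)
∈-subseqs⁺     (suc n) (x ∷ xs) {suc i} 1+n≤1+i 1+i<len s∈ =
  ∈-subseqs⁺ n xs (s≤s⁻¹ 1+n≤1+i) (s≤s⁻¹ 1+i<len) s∈

module _ {P : Pattern} {p q r s : ℕ}
         (decode : ∀ {a b c d} →
                   OrderIso (a ∷ b ∷ c ∷ d ∷ []) (p ∷ q ∷ r ∷ s ∷ []) ⇔ P a b c d) where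

  avoidsᵇ⇒ : ∀ l → T (avoidsᵇ l (p ∷ q ∷ r ∷ s ∷ [])) → Avoids P (length l) (at l)
  avoidsᵇ⇒ l avoids {i} {j} {k} {m} i<j j<k k<m m<len occurrence =
    Equivalence.to T-not avoids
      (any⁺ (λ s′ → orderIso s′ (p ∷ q ∷ r ∷ s ∷ [])) (lose quadruple∈ iso))
    where
    k<len = <-trans k<m m<len
    j<len = <-trans j<k k<len
    i<len = <-trans i<j j<len
    quadruple∈ : at l i ∷ at l j ∷ at l k ∷ at l m ∷ [] ∈ subseqs 4 l
    quadruple∈ = ∈-subseqs⁺ 0 l z≤n i<len (∈-subseqs⁺ (suc i) l i<j j<len
                   (∈-subseqs⁺ (suc j) l j<k k<len (∈-subseqs⁺ (suc k) l k<m m<len (here refl))))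
    iso = Equivalence.from orderIso⇔ (Equivalence.from decode occurrence)

  avoidsᵇ⇐ : ∀ l → Avoids P (length l) (at l) → T (avoidsᵇ l (p ∷ q ∷ r ∷ s ∷ []))
  avoidsᵇ⇐ l avoids = Equivalence.from T-not λ contains →
    let s′ , s′∈ , iso = find (any⁻ _ _ contains) in no-occurrence s′∈ iso
    where
    no-occurrence : ∀ {s′} → s′ ∈ subseqs 4 l → T (orderIso s′ (p ∷ q ∷ r ∷ s ∷ [])) → ⊥
    no-occurrence s′∈
      with i , _ , refl , _   , _     , ∈₁        ← ∈-subseqs⁻ 0 l s′∈
      with j , _ , refl , i<j , _     , ∈₂        ← ∈-subseqs⁻ (suc i) l ∈₁
      with k , _ , refl , j<k , _     , ∈₃        ← ∈-subseqs⁻ (suc j) l ∈₂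
      with m , _ , refl , k<m , m<len , here refl ← ∈-subseqs⁻ (suc k) l ∈₃
      = λ iso → avoids i<j j<k k<m m<len (Equivalence.to decode (Equivalence.to orderIso⇔ iso))

patterns : List (List ℕ)
patterns = (1 ∷ 3 ∷ 4 ∷ 2 ∷ []) ∷ (4 ∷ 2 ∷ 1 ∷ 3 ∷ []) ∷ []

classᵇ : List ℕ → Bool
classᵇ l = distinctᵇ l ∧ dumontᵇ l ∧ all (avoidsᵇ l) patterns

record D¹Word (N : ℕ) (l : List ℕ) : Set where
  constructor word
  field
    length≡  : length l ≡ N
    in-range : T (all (inRangeᵇ N) l)
    in-class : T (classᵇ l)

D¹Word⇒IsD¹ : ∀ {N l} → D¹Word N l → IsD¹ N (at l)
D¹Word⇒IsD¹ {l = l} (word refl in-range class)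
  with distinct , class′     ← ∧⁻ (distinctᵇ l) class
  with dumont , avoids       ← ∧⁻ (dumontᵇ l) class′
  with avoids-1342 , avoids′ ← ∧⁻ (avoidsᵇ l (1 ∷ 3 ∷ 4 ∷ 2 ∷ [])) avoids
  with avoids-4213 , _       ← ∧⁻ (avoidsᵇ l (4 ∷ 2 ∷ 1 ∷ 3 ∷ [])) avoids′
  = record
  { range       = Equivalence.to (range⇔ l) in-range
  ; injective   = Equivalence.to (distinct⇔ l) distinct
  ; steps       = proj₁ (dumontᵇ⇒ l dumont)
  ; last-odd    = proj₂ (dumontᵇ⇒ l dumont)
  ; avoids-1342 = avoidsᵇ⇒ orderIso-1342⇔ l avoids-1342
  ; avoids-4213 = avoidsᵇ⇒ orderIso-4213⇔ l avoids-4213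
  }

IsD¹⇒D¹Word : ∀ {N} l → length l ≡ N → IsD¹ N (at l) → D¹Word N l
IsD¹⇒D¹Word l refl D = word refl (Equivalence.from (range⇔ l) D.range)
  (∧⁺ (Equivalence.from (distinct⇔ l) D.injective)
  (∧⁺ (dumontᵇ⇐ l (D.steps , D.last-odd))
  (∧⁺ (avoidsᵇ⇐ orderIso-1342⇔ l D.avoids-1342)
  (∧⁺ (avoidsᵇ⇐ orderIso-4213⇔ l D.avoids-4213) tt))))
  where module D = IsD¹ D

D¹Word-inRange : ∀ {N l} → D¹Word N l → All (λ x → 1 ≤ x × x ≤ N) l
D¹Word-inRange {N} {l} w = All.map (Equivalence.to inRange⇔) (all⁺ (inRangeᵇ N) l (D¹Word.in-range w))

at-++ˡ : ∀ xs {ys i} → i < length xs → at (xs ++ ys) i ≡ at xs i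
at-++ˡ (x ∷ xs) {i = zero}  _       = refl
at-++ˡ (x ∷ xs) {i = suc i} 1+i<len = at-++ˡ xs (s≤s⁻¹ 1+i<len)

at-++-last₂ : ∀ (xs : List ℕ) {a b n} → length xs ≡ n →
              at (xs ++ a ∷ b ∷ []) n ≡ a × at (xs ++ a ∷ b ∷ []) (suc n) ≡ b
at-++-last₂ []       refl = refl , refl
at-++-last₂ (x ∷ xs) refl = at-++-last₂ xs refl

at-map : ∀ g xs {i} → i < length xs → at (map g xs) i ≡ g (at xs i)
at-map g (x ∷ xs) {zero}  _       = refl
at-map g (x ∷ xs) {suc i} 1+i<len = at-map g xs (s≤s⁻¹ 1+i<len)

at-take : ∀ n xs {i} → i < n → at (take n xs) i ≡ at xs i
at-take (suc n) []       _               = refl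
at-take (suc n) (x ∷ xs) {zero}  _       = refl
at-take (suc n) (x ∷ xs) {suc i} 1+i<1+n = at-take n xs (s≤s⁻¹ 1+i<1+n)

take-++ : ∀ (xs : List ℕ) {ys n} → length xs ≡ n → take n (xs ++ ys) ≡ xs
take-++ []       refl = refl
take-++ (x ∷ xs) refl = cong (x ∷_) (take-++ xs refl)

take-++-last₂ : ∀ N l → length l ≡ 2 + N → take N l ++ at l N ∷ at l (suc N) ∷ [] ≡ l
take-++-last₂ zero    (a ∷ b ∷ []) refl = refl
take-++-last₂ (suc N) (x ∷ xs)     len  = cong (x ∷_) (take-++-last₂ N xs (suc-injective len))

length-take-last₂ : ∀ N (l : List ℕ) → length l ≡ 2 + N → length (take N l) ≡ N
length-take-last₂ N l len = trans (length-take N l) (m≤n⇒m⊓n≡m (subst (N ≤_) (sym len) (m≤n+m N 2)))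

length-++-last₂ : ∀ (xs : List ℕ) {a b N} → length xs ≡ N → length (xs ++ a ∷ b ∷ []) ≡ 2 + N
length-++-last₂ xs refl = trans (length-++ xs) (+-comm (length xs) 2)

complement : ℕ → List ℕ → List ℕ
complement M = map (M ∸_)

length-complement : ∀ M l {N} → length l ≡ N → length (complement M l) ≡ N
length-complement M l len = trans (length-map (M ∸_) l) len

at-complement : ∀ M l {i} → i < length l → at l i ≤ M → at (complement M l) i + at l i ≡ M
at-complement M l {i} i<len li≤M = trans (cong (_+ at l i) (at-map (M ∸_) l i<len)) (m∸n+n≡m li≤M)

complement-involutive : ∀ {M} l → All (_≤ M) l → complement M (complement M l) ≡ l
complement-involutive l l≤M = trans (sym (map-∘ l)) (map-id-local (All.map m∸[m∸n]≡n l≤M))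

extendTop extendBottom : ℕ → List ℕ → List ℕ
extendTop    N s = s ++ 2 + N ∷ 1 + N ∷ []
extendBottom N s = complement (3 + N) s ++ 2 ∷ 1 ∷ []

D¹Word-extendTop : ∀ {N s} → Even N → D¹Word N s → D¹Word (2 + N) (extendTop N s)
D¹Word-extendTop {s = s} even-N w@(word len _ _) =
  IsD¹⇒D¹Word (extendTop _ s) (length-++-last₂ s len)
    (IsD¹-appendTop even-N (D¹Word⇒IsD¹ w) (λ i<N → at-++ˡ s (subst (_ <_) (sym len) i<N))
                    (proj₁ (at-++-last₂ s len)) (proj₂ (at-++-last₂ s len)))

D¹Word-extendBottom : ∀ {N s} → Even N → D¹Word N s → D¹Word (2 + N) (extendBottom N s)
D¹Word-extendBottom {N} {s} even-N w@(word len _ _) =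
  IsD¹⇒D¹Word (extendBottom N s) (length-++-last₂ (complement (3 + N) s) len′)
    (IsD¹-appendBottom even-N D complementary-s
                       (proj₁ (at-++-last₂ (complement (3 + N) s) len′))
                       (proj₂ (at-++-last₂ (complement (3 + N) s) len′)))
  where
  D = D¹Word⇒IsD¹ w
  len′ = length-complement (3 + N) s len
  complementary-s : Complement (3 + N) N (at (extendBottom N s)) (at s)
  complementary-s = complementary λ {i} i<N →
    trans (cong (_+ at s i) (at-++ˡ (complement (3 + N) s) (subst (i <_) (sym len′) i<N)))
          (at-complement (3 + N) s (subst (i <_) (sym len) i<N) (m≤n⇒m≤o+n 3 (proj₂ (IsD¹.range D i<N))))

D¹Word-dropTop : ∀ {N l} → Even N → D¹Word (2 + N) l → at l (suc N) ≢ 1 → D¹Word N (take N l)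
D¹Word-dropTop {N} {l} even-N w@(word len _ _) last≢1 =
  IsD¹⇒D¹Word (take N l) (length-take-last₂ N l len)
    (IsD¹-removeTop D (proj₁ top) (proj₂ top) (at-take N l))
  where
  D   = D¹Word⇒IsD¹ w
  top = LastBlock.last≢1⇒top-block D even-N last≢1

D¹Word-dropBottom : ∀ {N l} → Even N → D¹Word (2 + N) l → at l (suc N) ≡ 1 →
                    D¹Word N (complement (3 + N) (take N l))
D¹Word-dropBottom {N} {l} even-N w@(word len _ _) last≡1 =
  IsD¹⇒D¹Word (complement (3 + N) (take N l)) (length-complement (3 + N) (take N l) len′)
    (IsD¹-removeBottom D even-N (LastBlock.last≡1⇒penultimate≡2 D even-N last≡1) last≡1 complementary-l)
  where
  D = D¹Word⇒IsD¹ w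
  len′ = length-take-last₂ N l len
  below-3+N : ∀ {i} → i < N → at l i ≤ 3 + N
  below-3+N i<N = m≤n⇒m≤1+n (proj₂ (IsD¹.range D (<-trans i<N (m<n⇒m<1+n (n<1+n N)))))
  complementary-l : Complement (3 + N) N (at l) (at (complement (3 + N) (take N l)))
  complementary-l = complement-sym (complementary λ {i} i<N →
    subst (λ v → at (complement (3 + N) (take N l)) i + v ≡ 3 + N) (at-take N l i<N)
      (at-complement (3 + N) (take N l) (subst (i <_) (sym len′) i<N)
        (subst (_≤ 3 + N) (sym (at-take N l i<N)) (below-3+N i<N))))

complement-take-extendBottom : ∀ {N s} → D¹Word N s → complement (3 + N) (take N (extendBottom N s)) ≡ s
complement-take-extendBottom {N} {s} w@(word len _ _) = begin
  complement (3 + N) (take N (extendBottom N s))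
    ≡⟨ cong (complement (3 + N)) (take-++ (complement (3 + N) s) (length-complement (3 + N) s len)) ⟩
  complement (3 + N) (complement (3 + N) s)
    ≡⟨ complement-involutive s bounded ⟩
  s ∎
  where
  open ≡-Reasoning
  bounded = All.map (m≤n⇒m≤o+n 3 ∘ proj₂) (D¹Word-inRange w)

extendTop-take : ∀ {N l} → Even N → D¹Word (2 + N) l → at l (suc N) ≢ 1 → extendTop N (take N l) ≡ l
extendTop-take {N} {l} even-N w@(word len _ _) last≢1 = begin
  take N l ++ 2 + N ∷ 1 + N ∷ []
    ≡⟨ cong₂ (λ a b → take N l ++ a ∷ b ∷ []) (sym (proj₁ top)) (sym (proj₂ top)) ⟩
  take N l ++ at l N ∷ at l (suc N) ∷ []
    ≡⟨ take-++-last₂ N l len ⟩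
  l ∎
  where
  open ≡-Reasoning
  top = LastBlock.last≢1⇒top-block (D¹Word⇒IsD¹ w) even-N last≢1

extendBottom-take : ∀ {N l} → Even N → D¹Word (2 + N) l → at l (suc N) ≡ 1 →
                    extendBottom N (complement (3 + N) (take N l)) ≡ l
extendBottom-take {N} {l} even-N w@(word len _ _) last≡1 = begin
  complement (3 + N) (complement (3 + N) (take N l)) ++ 2 ∷ 1 ∷ []
    ≡⟨ cong (_++ 2 ∷ 1 ∷ []) (complement-involutive (take N l) (take⁺ N bounded)) ⟩
  take N l ++ 2 ∷ 1 ∷ []
    ≡⟨ cong₂ (λ a b → take N l ++ a ∷ b ∷ []) (sym penultimate≡2) (sym last≡1) ⟩
  take N l ++ at l N ∷ at l (suc N) ∷ []
    ≡⟨ take-++-last₂ N l len ⟩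
  l ∎
  where
  open ≡-Reasoning
  bounded = All.map (m≤n⇒m≤o+n 1 ∘ proj₂) (D¹Word-inRange w)
  penultimate≡2 = LastBlock.last≡1⇒penultimate≡2 (D¹Word⇒IsD¹ w) even-N last≡1

-- Counting

𝔇¹ : ℕ → Set
𝔇¹ N = Σ (List ℕ) (D¹Word N)

𝔇¹-≡ : ∀ {N} {w w′ : 𝔇¹ N} → proj₁ w ≡ proj₁ w′ → w ≡ w′
𝔇¹-≡ {w = l , word len in-range class} {.l , word len′ in-range′ class′} refl
  rewrite ≡-irrelevant len len′ | T-irrelevant in-range in-range′ | T-irrelevant class class′ = refl

𝔇¹-step : ∀ {N} → Even N → 0 < N → 𝔇¹ (2 + N) ↔ (𝔇¹ N ⊎ 𝔇¹ N)
𝔇¹-step {N} even-N 0<N = mk↔ₛ′ split join split∘join join∘split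
  where
  join : 𝔇¹ N ⊎ 𝔇¹ N → 𝔇¹ (2 + N)
  join (inj₁ (s , w)) = extendTop N s , D¹Word-extendTop even-N w
  join (inj₂ (s , w)) = extendBottom N s , D¹Word-extendBottom even-N w

  split : 𝔇¹ (2 + N) → 𝔇¹ N ⊎ 𝔇¹ N
  split (l , w) with at l (suc N) ≟ 1
  ... | no  last≢1 = inj₁ (take N l , D¹Word-dropTop even-N w last≢1)
  ... | yes last≡1 = inj₂ (complement (3 + N) (take N l) , D¹Word-dropBottom even-N w last≡1)

  split∘join : ∀ x → split (join x) ≡ x
  split∘join (inj₁ (s , w@(word len _ _))) with at (extendTop N s) (suc N) ≟ 1
  ... | no  _      = cong inj₁ (𝔇¹-≡ (take-++ s len))
  ... | yes last≡1 =
    ⊥-elim (<⇒≢ 0<N (sym (suc-injective (trans (sym (proj₂ (at-++-last₂ s len))) last≡1))))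
  split∘join (inj₂ (s , w@(word len _ _))) with at (extendBottom N s) (suc N) ≟ 1
  ... | no  last≢1 =
    ⊥-elim (last≢1 (proj₂ (at-++-last₂ (complement (3 + N) s) (length-complement (3 + N) s len))))
  ... | yes _      = cong inj₂ (𝔇¹-≡ (complement-take-extendBottom w))

  join∘split : ∀ y → join (split y) ≡ y
  join∘split (l , w) with at l (suc N) ≟ 1
  ... | no  last≢1 = 𝔇¹-≡ (extendTop-take even-N w last≢1)
  ... | yes last≡1 = 𝔇¹-≡ (extendBottom-take even-N w last≡1)

𝔇¹-base : 𝔇¹ 2 ↔ Fin 1
𝔇¹-base = mk↔ₛ′ (λ _ → fzero) (λ _ → 2 ∷ 1 ∷ [] , word refl _ _)
                 (λ { fzero → refl ; (fsuc ()) }) (λ { (l , w) → 𝔇¹-≡ (sym (the-only-word w)) })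
  where
  the-only-word : ∀ {l} → D¹Word 2 l → l ≡ 2 ∷ 1 ∷ []
  the-only-word {a ∷ b ∷ []} w with b ≟ 1
  ... | yes b≡1 =
    cong₂ (λ x y → x ∷ y ∷ []) (LastBlock.last≡1⇒penultimate≡2 (D¹Word⇒IsD¹ w) refl b≡1) b≡1
  ... | no  b≢1 = ⊥-elim (b≢1 (proj₂ (LastBlock.last≢1⇒top-block (D¹Word⇒IsD¹ w) refl b≢1)))

even-double : ∀ n → Even (2 * n)
even-double zero    = refl
even-double (suc n) = trans (cong evenᵇ (*-suc 2 n)) (even-double n)

Fin-double : ∀ n → Fin (2 ^ suc n) ↔ (Fin (2 ^ n) ⊎ Fin (2 ^ n))
Fin-double n = subst (λ k → Fin (2 ^ suc n) ↔ (Fin (2 ^ n) ⊎ Fin k)) (+-identityʳ (2 ^ n)) +↔⊎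

𝔇¹-count : ∀ n → 𝔇¹ (2 * suc n) ↔ Fin (2 ^ n)
𝔇¹-count zero    = 𝔇¹-base
𝔇¹-count (suc n) = subst (λ N → 𝔇¹ N ↔ Fin (2 ^ suc n)) (sym (*-suc 2 (suc n)))
  (↔-sym (Fin-double n) ↔-∘
    ((𝔇¹-count n ⊎-↔ 𝔇¹-count n) ↔-∘ 𝔇¹-step (even-double (suc n)) (s≤s z≤n)))

-- From vectors to one-line words

-- The one-line notation oneLine of Defs, for vectors whose length may differ from the alphabet size.
values : ∀ {m K} → Vec (Fin m) K → List ℕ
values v = map (λ i → suc (toℕ i)) (toList v)

clamp : ∀ {m} → ℕ → Fin (suc m)
clamp {zero}  _       = fzero
clamp {suc m} zero    = fzero
clamp {suc m} (suc x) = fsuc (clamp x)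

clamp-toℕ : ∀ {m} (i : Fin (suc m)) → clamp (toℕ i) ≡ i
clamp-toℕ {zero}  fzero    = refl
clamp-toℕ {suc m} fzero    = refl
clamp-toℕ {suc m} (fsuc i) = cong fsuc (clamp-toℕ i)

toℕ-clamp : ∀ {m x} → x ≤ m → toℕ (clamp {m} x) ≡ x
toℕ-clamp {zero}  z≤n       = refl
toℕ-clamp {suc m} z≤n       = refl
toℕ-clamp {suc m} (s≤s x≤m) = cong suc (toℕ-clamp x≤m)

vectorOf : ∀ {m} K → List ℕ → Vec (Fin (suc m)) K
vectorOf zero    _        = []ᵥ
vectorOf (suc K) []       = fzero ∷ᵥ vectorOf K []
vectorOf (suc K) (x ∷ xs) = clamp (pred x) ∷ᵥ vectorOf K xs

vectorOf-values : ∀ {m K} (v : Vec (Fin (suc m)) K) → vectorOf K (values v) ≡ v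
vectorOf-values []ᵥ       = refl
vectorOf-values (i ∷ᵥ v) = cong₂ _∷ᵥ_ (clamp-toℕ i) (vectorOf-values v)

values-vectorOf : ∀ {m K l} → length l ≡ K → All (λ x → 1 ≤ x × x ≤ suc m) l →
                  values (vectorOf {m} K l) ≡ l
values-vectorOf {K = zero}  {[]}     refl []                      = refl
values-vectorOf {K = suc K} {x ∷ xs} len  ((s≤s _ , x≤1+m) ∷ xs≤) =
  cong₂ _∷_ (cong suc (toℕ-clamp (s≤s⁻¹ x≤1+m))) (values-vectorOf (suc-injective len) xs≤)

length-values : ∀ {m K} (v : Vec (Fin m) K) → length (values v) ≡ K
length-values []ᵥ       = refl
length-values (_ ∷ᵥ v) = cong suc (length-values v)

values-inRange : ∀ {m K} (v : Vec (Fin m) K) → All (λ x → 1 ≤ x × x ≤ m) (values v)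
values-inRange []ᵥ       = []
values-inRange (i ∷ᵥ v) = (s≤s z≤n , toℕ<n i) ∷ values-inRange v

oneLine↔𝔇¹ : ∀ {m} → Σ (Vec (Fin (suc m)) (suc m)) (T ∘ classᵇ ∘ oneLine) ↔ 𝔇¹ (suc m)
oneLine↔𝔇¹ {m} = mk↔ₛ′ to from to∘from from∘to
  where
  to : Σ (Vec (Fin (suc m)) (suc m)) (T ∘ classᵇ ∘ oneLine) → 𝔇¹ (suc m)
  to (v , class) = values v , word (length-values v) in-range class
    where in-range = all⁻ _ (All.map (Equivalence.from inRange⇔) (values-inRange v))
  values-vectorOf-word : ∀ (w : 𝔇¹ (suc m)) → values (vectorOf (suc m) (proj₁ w)) ≡ proj₁ w
  values-vectorOf-word (l , w) = values-vectorOf (D¹Word.length≡ w) (D¹Word-inRange w)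
  from : 𝔇¹ (suc m) → Σ (Vec (Fin (suc m)) (suc m)) (T ∘ classᵇ ∘ oneLine)
  from (l , w) =
    vectorOf (suc m) l , subst (T ∘ classᵇ) (sym (values-vectorOf-word (l , w))) (D¹Word.in-class w)
  to∘from : ∀ w → to (from w) ≡ w
  to∘from w = 𝔇¹-≡ (values-vectorOf-word w)
  from∘to : ∀ x → from (to x) ≡ x
  from∘to (v , class) = Σ-≡ (vectorOf-values v)
    where
    Σ-≡ : ∀ {x y : Σ (Vec (Fin (suc m)) (suc m)) (T ∘ classᵇ ∘ oneLine)} →
          proj₁ x ≡ proj₁ y → x ≡ y
    Σ-≡ {v , c} {.v , c′} refl = cong (v ,_) (T-irrelevant c c′)

theorem3p9 : (n : ℕ) → D1 (suc n) ((1 ∷ 3 ∷ 4 ∷ 2 ∷ []) ∷ (4 ∷ 2 ∷ 1 ∷ 3 ∷ []) ∷ []) ⤖ Fin (2 ^ n)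
theorem3p9 n = ↔⇒⤖ (𝔇¹-count n ↔-∘ oneLine↔𝔇¹)
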